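{- Let \((X,\sqsubseteq)\) be a locally small \(\delta_{\mathcal V}\)-complete poset and \(x,y:X\) with \(x\sqsubseteq y\). Then \(x\) is strictly below \(y\) if and only if for every \(z:X\) with \(y\sqsubseteq z\), the map \(\Delta_{x,z}:\Omega_{\mathcal V}\to X\), \(P\mapsto\bigvee\delta_{x,z,P}\), is a section (has a left inverse \(r_z:X\to\Omega_{\mathcal V}\)).
   Context: Work in univalent foundations (intensional Martin-Löf type theory with universes, function and propositional extensionality, propositional truncations). \(\Omega_{\mathcal V}\) is the type of propositions in \(\mathcal V\). A poset is a type with a proposition-valued reflexive, transitive, antisymmetric relation \(\sqsubseteq\). It is \(\delta_{\mathcal V}\)-complete if for all \(a\sqsubseteq b\) and propositions \(P:\mathcal V\) the family \(\delta_{a,b,P}:\mathbf 1+P\to X\), \(\mathrm{inl}(\star)\mapsto a\), \(\mathrm{inr}(p)\mapsto b\), has a supremum \(\bigvee\delta_{a,b,P}\). It is locally small if there is \(\sqsubseteq_{\mathcal V}:X\to X\to\mathcal V\) with \((a\sqsubseteq b)\simeq(a\sqsubseteq_{\mathcal V}b)\). \(x\) is strictly below \(y\) if \(x\sqsubseteq y\) and for every \(z\sqsupseteq y\) and every proposition \(P:\mathcal V\), \(z=\bigvee\delta_{x,z,P}\) implies \(P\). A map \(s\) is a section if there is \(r\) with \(r\circ s\sim\mathrm{id}\). -}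

module Defs where

open import Level using (Level; _⊔_; suc)
open import Data.Unit using (⊤; tt)
open import Data.Sum using (_⊎_; inj₁; inj₂)
open import Data.Product using (Σ; _×_; _,_; proj₁; proj₂)
open import Function.Bundles using (_↔_)
open import Relation.Binary.PropositionalEquality using (_≡_)

private variable u t v : Level

isProp : {ℓ : Level} → Set ℓ → Set ℓ
isProp A = (a b : A) → a ≡ b

Ω : (v : Level) → Set (suc v)
Ω v = Σ (Set v) isProp

PropExt : (v : Level) → Set (suc v)
PropExt v = (P Q : Set v) → isProp P → isProp Q → (P → Q) → (Q → P) → P ≡ Q

record PosetStr (X : Set u) (t : Level) : Set (u ⊔ suc t) where
  field
    _⊑_     : X → X → Set t
    ⊑-prop  : (a b : X) → isProp (a ⊑ b)
    ⊑-refl  : (a : X) → a ⊑ a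
    ⊑-trans : (a b c : X) → a ⊑ b → b ⊑ c → a ⊑ c
    ⊑-antisym : (a b : X) → a ⊑ b → b ⊑ a → a ≡ b

module _ {X : Set u} (S : PosetStr X t) where
  open PosetStr S

  isSup : {ℓ : Level} {I : Set ℓ} → (I → X) → X → Set (u ⊔ t ⊔ ℓ)
  isSup {I = I} α s = ((i : I) → α i ⊑ s) × ((w : X) → ((i : I) → α i ⊑ w) → s ⊑ w)

  LocallySmall : (v : Level) → Set (u ⊔ t ⊔ suc v)
  LocallySmall v = Σ (X → X → Set v) λ _⊑V_ → (a b : X) → (a ⊑ b) ↔ (a ⊑V b)

  δ : (a b : X) (P : Ω v) → ⊤ ⊎ proj₁ P → X
  δ a b P (inj₁ _) = a
  δ a b P (inj₂ _) = b

  δComplete : (v : Level) → Set (u ⊔ t ⊔ suc v)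
  δComplete v = (a b : X) → a ⊑ b → (P : Ω v) → Σ X (isSup (δ a b P))

  module _ {v : Level} (c : δComplete v) where
    ⋁δ : (a b : X) → a ⊑ b → Ω v → X
    ⋁δ a b a⊑b P = proj₁ (c a b a⊑b P)

    StrictlyBelow : X → X → Set (u ⊔ t ⊔ suc v)
    StrictlyBelow x y = Σ (x ⊑ y) λ x⊑y →
      (z : X) (y⊑z : y ⊑ z) (P : Ω v) →
      z ≡ ⋁δ x z (⊑-trans x y z x⊑y y⊑z) P → proj₁ P

isSection : {A : Set u} {B : Set t} → (A → B) → Set (u ⊔ t)
isSection {A = A} {B} s = Σ (B → A) λ r → (a : A) → r (s a) ≡ a

-- If x is strictly below y and y ⊑ z, the proposition z ⊑ ⋁δ_{x,z,P} holds exactly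
-- when P does (one direction because ⋁δ_{x,z,P} ⊑ z, the other by strictness), so
-- w ↦ (z ⊑_V w) is a left inverse of Δ_{x,z}; propositional extensionality turns the
-- equivalence into an equality in Ω_V.  Conversely a section is injective, and
-- Δ_{x,z}(⊤) = z, so z = Δ_{x,z}(P) forces P = ⊤.
{-# OPTIONS --safe #-}
module Submission where

open import Defs
open import Level using (Level; _⊔_; suc)
open import Data.Product using (_,_; proj₁; proj₂)
open import Data.Sum using (inj₁; inj₂)
open import Data.Unit.Polymorphic using (⊤; tt)
open import Function.Bundles using (_⇔_; _↔_; Inverse; mk⇔)
open import Axiom.Extensionality.Propositional using (Extensionality)
open import Axiom.UniquenessOfIdentityProofs using (UIP; module Constant⇒UIP)
open import Relation.Binary.PropositionalEquality

private variable ℓ ℓ′ u t v : Level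

isProp⇒UIP : {A : Set ℓ} → isProp A → UIP A
isProp⇒UIP prop = Constant⇒UIP.≡-irrelevant (λ {a} {b} _ → prop a b) (λ _ _ → refl)

isProp-isProp : (∀ {a b} → Extensionality a b) → {A : Set ℓ} → isProp (isProp A)
isProp-isProp funext p q = funext λ a → funext λ b → isProp⇒UIP p (p a b) (q a b)

↔-isProp : {A : Set ℓ} {B : Set ℓ′} → A ↔ B → isProp A → isProp B
↔-isProp A↔B propA b b′ = begin
  b                     ≡⟨ sym (strictlyInverseˡ b) ⟩
  to (from b)           ≡⟨ cong to (propA (from b) (from b′)) ⟩
  to (from b′)          ≡⟨ strictlyInverseˡ b′ ⟩
  b′                    ∎
  where open Inverse A↔B
        open ≡-Reasoning

Ω-≡ : (∀ {a b} → Extensionality a b) → PropExt v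
    → (P Q : Ω v) → (proj₁ P → proj₁ Q) → (proj₁ Q → proj₁ P) → P ≡ Q
Ω-≡ funext propext (P , propP) (Q , propQ) P→Q Q→P
  with refl ← propext P Q propP propQ P→Q Q→P
  = cong (P ,_) (isProp-isProp funext propP propQ)

⊤Ω : Ω v
⊤Ω = ⊤ , λ _ _ → refl

≡⊤Ω⇒holds : {P : Ω v} → P ≡ ⊤Ω → proj₁ P
≡⊤Ω⇒holds refl = tt

isSection⇒injective : {A : Set ℓ} {B : Set ℓ′} {s : A → B}
                    → isSection s → ∀ {a a′} → s a ≡ s a′ → a ≡ a′
isSection⇒injective (r , r∘s≗id) {a} {a′} sa≡sa′ =
  trans (sym (r∘s≗id a)) (trans (cong r sa≡sa′) (r∘s≗id a′))

module _ {X : Set u} (S : PosetStr X t) {v : Level} (c : δComplete S v) where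
  open PosetStr S

  private
    Δ : (a b : X) → a ⊑ b → Ω v → X
    Δ = ⋁δ S c

  ⋁δ-upper : ∀ {a b} (a⊑b : a ⊑ b) (P : Ω v) → proj₁ P → b ⊑ Δ a b a⊑b P
  ⋁δ-upper {a} {b} a⊑b P p = proj₁ (proj₂ (c a b a⊑b P)) (inj₂ p)

  ⋁δ-⊑-right : ∀ {a b} (a⊑b : a ⊑ b) (P : Ω v) → Δ a b a⊑b P ⊑ b
  ⋁δ-⊑-right {a} {b} a⊑b P = proj₂ (proj₂ (c a b a⊑b P)) b bounded
    where
      bounded : ∀ i → δ S a b P i ⊑ b
      bounded (inj₁ _) = a⊑b
      bounded (inj₂ _) = ⊑-refl b

  ⋁δ-⊤ : ∀ {a b} (a⊑b : a ⊑ b) → Δ a b a⊑b ⊤Ω ≡ b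
  ⋁δ-⊤ {b = b} a⊑b = ⊑-antisym _ b (⋁δ-⊑-right a⊑b ⊤Ω) (⋁δ-upper a⊑b ⊤Ω tt)

  -- StrictlyBelow x y says that ReflectsTop x z holds for every z ⊒ y.
  ReflectsTop : (a b : X) → a ⊑ b → Set (u ⊔ suc v)
  ReflectsTop a b a⊑b = (P : Ω v) → b ≡ Δ a b a⊑b P → proj₁ P

  isSection⇒ReflectsTop : ∀ {a b} (a⊑b : a ⊑ b)
                        → isSection (Δ a b a⊑b) → ReflectsTop a b a⊑b
  isSection⇒ReflectsTop a⊑b section P b≡ΔP = ≡⊤Ω⇒holds
    (isSection⇒injective section (trans (sym b≡ΔP) (sym (⋁δ-⊤ a⊑b))))

  ReflectsTop⇒isSection : (∀ {a b} → Extensionality a b) → PropExt v → LocallySmall S v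
                        → ∀ {a b} (a⊑b : a ⊑ b) → ReflectsTop a b a⊑b → isSection (Δ a b a⊑b)
  ReflectsTop⇒isSection funext propext (_⊑V_ , ⊑↔⊑V) {a} {b} a⊑b reflects = r , r∘Δ≗id
    where
      r : X → Ω v
      r w = (b ⊑V w) , ↔-isProp (⊑↔⊑V b w) (⊑-prop b w)

      r∘Δ≗id : (P : Ω v) → r (Δ a b a⊑b P) ≡ P
      r∘Δ≗id P = Ω-≡ funext propext (r ΔP) P
        (λ b⊑VΔP → reflects P (⊑-antisym b ΔP (Inverse.from (⊑↔⊑V b ΔP) b⊑VΔP)
                                               (⋁δ-⊑-right a⊑b P)))
        (λ p → Inverse.to (⊑↔⊑V b ΔP) (⋁δ-upper a⊑b P p))
        where ΔP = Δ a b a⊑b P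

lemma4p22 : {u t v : Level}
    → (funext : ∀ {a b} → Extensionality a b)
    → (propext : PropExt v)
    → (X : Set u) (S : PosetStr X t)
    → LocallySmall S v
    → (c : δComplete S v)
    → (x y : X) (x⊑y : PosetStr._⊑_ S x y)
    → StrictlyBelow S c x y
      ⇔ ((z : X) (y⊑z : PosetStr._⊑_ S y z)
          → isSection (⋁δ S c x z (PosetStr.⊑-trans S x y z x⊑y y⊑z)))
lemma4p22 funext propext X S locallySmall c x y x⊑y = mk⇔ strict⇒section section⇒strict
  where
    open PosetStr S

    strict⇒section : StrictlyBelow S c x y → ∀ z y⊑z → isSection (⋁δ S c x z (⊑-trans x y z x⊑y y⊑z))
    strict⇒section (x⊑y′ , strict) z y⊑z
      with refl ← ⊑-prop x y x⊑y x⊑y′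
      = ReflectsTop⇒isSection S c funext propext locallySmall _ (strict z y⊑z)

    section⇒strict : (∀ z y⊑z → isSection (⋁δ S c x z (⊑-trans x y z x⊑y y⊑z))) → StrictlyBelow S c x y
    section⇒strict sections = x⊑y , λ z y⊑z → isSection⇒ReflectsTop S c _ (sections z y⊑z)
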